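{- Let $\mathscr D,\mathscr Q$ be disjoint schemas. Every DTGD$[\mathsf{UCQ}]$-ontology $O$ over $(\mathscr D,\mathscr Q)$ is closed under constant substitutions: if $(D,q)\in O$ and $\tau$ is a partial function from $\Delta$ to $\Delta$, then $(\tau(D),\tau(q))\in O$.
   Context: Terms are constants (set $\Delta$), labeled nulls, or variables. A fact is a variable-free relational atom; a database is a finite set of facts without nulls; $adom(D)$ its constants. A Boolean UCQ is a sentence built from relational atoms (constants allowed) with only $\wedge,\vee,\exists$; $const(q)$ its constants. $\tau(D)$, $\tau(q)$ denote the results of replacing each constant $c$ in the domain of $\tau$ by $\tau(c)$. A DTGD is a sentence $\forall\mathbf x\forall\mathbf y(\phi\rightarrow\exists\mathbf z(\psi_1\vee\dots\vee\psi_k))$ with $\phi,\psi_i$ conjunctions of relational atoms, every universally quantified variable of the head occurring in $\phi$. $D\cup\Sigma\vDash q$ means every instance containing $D$ and satisfying $\Sigma$ satisfies $q$. An OMQA$[\mathsf{UCQ}]$-ontology over $(\mathscr D,\mathscr Q)$ is a set $O$ of pairs $(D,q)$, $D$ a nonempty $\mathscr D$-database, $q$ a Boolean $\mathscr Q$-UCQ with $const(q)\subseteq adom(D)$, closed under query conjunction ($(D,p),(D,q)\in O\Rightarrow(D,p\wedge q)\in O$), query implication ($q\vDash p$, $(D,q)\in O\Rightarrow(D,p)\in O$), injective $const(q)$-fixing homomorphisms of databases ($(D,q)\in O$ and such a map sends $D$ into $D'$ $\Rightarrow(D',q)\in O$), and partial injective renamings $\tau:\Delta\to\Delta$. A DTGD$[\mathsf{UCQ}]$-ontology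 is such an $O$ equal to $\{(D,q): D$ a $\mathscr D$-database, $q$ a Boolean $\mathscr Q$-UCQ, $D\cup\Sigma\vDash q\}$ for some finite set $\Sigma$ of DTGDs. -}

module Defs where

open import Data.Nat using (ℕ)
open import Data.Product using (Σ; ∃; _×_; _,_; proj₁; proj₂)
open import Data.Sum using (_⊎_; inj₁; inj₂)
open import Data.Empty using (⊥)
open import Data.Maybe using (Maybe; just; nothing)
open import Data.List using (List; []; _∷_; map)
open import Data.List.Membership.Propositional using (_∈_)
open import Data.List.Relation.Unary.All using (All)
open import Data.List.Relation.Unary.Any using (Any)
open import Data.Vec using (Vec)
import Data.Vec as Vec
open import Data.Vec.Membership.Propositional using () renaming (_∈_ to _∈ᵥ_)
open import Relation.Binary.PropositionalEquality using (_≡_)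
open import Relation.Nullary using (¬_)

Const : Set
Const = ℕ

Null : Set
Null = ℕ

Var : Set
Var = ℕ

-- A relation symbol: (name , arity).  Infinitely many of each arity.
RelSym : Set
RelSym = ℕ × ℕ

arity : RelSym → ℕ
arity = proj₂

Schema : Set
Schema = List RelSym

Disjoint : Schema → Schema → Set
Disjoint S T = ∀ R → R ∈ S → R ∈ T → ⊥

record Atom (T : Set) : Set where
  constructor _⟨_⟩
  field
    rel  : RelSym
    args : Vec T (arity rel)
open Atom public

mapAtom : {A B : Set} → (A → B) → Atom A → Atom B
mapAtom f (R ⟨ ts ⟩) = R ⟨ Vec.map f ts ⟩

Fact : Set
Fact = Atom Const

Database : Set
Database = List Fact

IsSchemaDB : Schema → Database → Set
IsSchemaDB S D = All (λ f → rel f ∈ S) D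

NonEmpty : Database → Set
NonEmpty D = ¬ (D ≡ [])

_∈adom_ : Const → Database → Set
c ∈adom D = Any (λ f → c ∈ᵥ args f) D

-- Boolean UCQs (positive existential sentences, constants allowed)

data Term : Set where
  var : Var → Term
  cst : Const → Term

data UCQ : Set where
  atom : Atom Term → UCQ
  _∧_  : UCQ → UCQ → UCQ
  _∨_  : UCQ → UCQ → UCQ
  ex   : Var → UCQ → UCQ

data FreeIn (x : Var) : UCQ → Set where
  atom : ∀ {a} → var x ∈ᵥ args a → FreeIn x (atom a)
  ∧ˡ   : ∀ {p q} → FreeIn x p → FreeIn x (p ∧ q)
  ∧ʳ   : ∀ {p q} → FreeIn x q → FreeIn x (p ∧ q)
  ∨ˡ   : ∀ {p q} → FreeIn x p → FreeIn x (p ∨ q)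
  ∨ʳ   : ∀ {p q} → FreeIn x q → FreeIn x (p ∨ q)
  ex   : ∀ {y p} → ¬ (x ≡ y) → FreeIn x p → FreeIn x (ex y p)

IsSentence : UCQ → Set
IsSentence q = ∀ x → ¬ FreeIn x q

data ConstIn (c : Const) : UCQ → Set where
  atom : ∀ {a} → cst c ∈ᵥ args a → ConstIn c (atom a)
  ∧ˡ   : ∀ {p q} → ConstIn c p → ConstIn c (p ∧ q)
  ∧ʳ   : ∀ {p q} → ConstIn c q → ConstIn c (p ∧ q)
  ∨ˡ   : ∀ {p q} → ConstIn c p → ConstIn c (p ∨ q)
  ∨ʳ   : ∀ {p q} → ConstIn c q → ConstIn c (p ∨ q)
  ex   : ∀ {y p} → ConstIn c p → ConstIn c (ex y p)

data OverSchema (S : Schema) : UCQ → Set where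
  atom : ∀ {a} → rel a ∈ S → OverSchema S (atom a)
  _∧_  : ∀ {p q} → OverSchema S p → OverSchema S q → OverSchema S (p ∧ q)
  _∨_  : ∀ {p q} → OverSchema S p → OverSchema S q → OverSchema S (p ∨ q)
  ex   : ∀ {y p} → OverSchema S p → OverSchema S (ex y p)

-- DTGDs  ∀x∀y (φ → ∃z (ψ₁ ∨ … ∨ ψₖ)), constant-free.
-- The head variables not occurring in the body are the existential ones (z).

record DTGD : Set where
  constructor dtgd
  field
    body  : List (Atom Var)
    heads : List (List (Atom Var))
open DTGD public

Dom : Set
Dom = Const ⊎ Null

Instance : Set₁
Instance = Atom Dom → Set

evalTerm : (Var → Dom) → Term → Dom
evalTerm ν (var x) = ν x
evalTerm ν (cst c) = inj₁ c

update : (Var → Dom) → Var → Dom → (Var → Dom)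
update ν x d y with Data.Nat._≟_ y x
... | Relation.Nullary.yes _ = d
... | Relation.Nullary.no  _ = ν y

SatQ : Instance → (Var → Dom) → UCQ → Set
SatQ I ν (atom a) = I (mapAtom (evalTerm ν) a)
SatQ I ν (p ∧ q)  = SatQ I ν p × SatQ I ν q
SatQ I ν (p ∨ q)  = SatQ I ν p ⊎ SatQ I ν q
SatQ I ν (ex x p) = ∃ λ d → SatQ I (update ν x d) p

_⊨Q_ : Instance → UCQ → Set
I ⊨Q q = ∀ (ν : Var → Dom) → SatQ I ν q

HoldsConj : Instance → (Var → Dom) → List (Atom Var) → Set
HoldsConj I g as = All (λ a → I (mapAtom g a)) as

OccursIn : Var → List (Atom Var) → Set
OccursIn x as = Any (λ a → x ∈ᵥ args a) as

_⊨T_ : Instance → DTGD → Set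
I ⊨T σ = ∀ (g : Var → Dom) → HoldsConj I g (body σ) →
  Any (λ ψ → ∃ λ (g' : Var → Dom) →
              (∀ x → OccursIn x (body σ) → g' x ≡ g x) × HoldsConj I g' ψ)
      (heads σ)

_⊨Σ_ : Instance → List DTGD → Set
I ⊨Σ Σ' = All (λ σ → I ⊨T σ) Σ'

Contains : Instance → Database → Set
Contains I D = All (λ f → I (mapAtom inj₁ f)) D

Entails : Database → List DTGD → UCQ → Set₁
Entails D Σ' q = ∀ (I : Instance) → Contains I D → I ⊨Σ Σ' → I ⊨Q q

WellFormedPair : Schema → Schema → Database → UCQ → Set
WellFormedPair 𝒟 𝒬 D q =
  NonEmpty D × IsSchemaDB 𝒟 D × IsSentence q × OverSchema 𝒬 q ×
  (∀ c → ConstIn c q → c ∈adom D)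

Ontology : Set₂
Ontology = Database → UCQ → Set₁

IsDTGDOntology : Schema → Schema → Ontology → Set₁
IsDTGDOntology 𝒟 𝒬 O = Σ (List DTGD) λ Σ' → ∀ D q →
  ((O D q → WellFormedPair 𝒟 𝒬 D q × Entails D Σ' q) ×
   (WellFormedPair 𝒟 𝒬 D q → Entails D Σ' q → O D q))

PartialFun : Set
PartialFun = Const → Maybe Const

applyτ : PartialFun → Const → Const
applyτ τ c with τ c
... | just d  = d
... | nothing = c

substTerm : PartialFun → Term → Term
substTerm τ (var x) = var x
substTerm τ (cst c) = cst (applyτ τ c)

substDB : PartialFun → Database → Database
substDB τ D = map (mapAtom (applyτ τ)) D

substQ : PartialFun → UCQ → UCQ
substQ τ (atom a) = atom (mapAtom (substTerm τ) a)
substQ τ (p ∧ q)  = substQ τ p ∧ substQ τ q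
substQ τ (p ∨ q)  = substQ τ p ∨ substQ τ q
substQ τ (ex x p) = ex x (substQ τ p)

-- Let h : Dom → Dom act as τ on constants and map the nulls onto the whole of Dom.
-- Given a model I of Σ containing τ(D), its preimage h⁻¹(I) contains D, and it is
-- still a model of Σ: the DTGDs are constant-free, so a body match in h⁻¹(I) is sent
-- by h to a body match in I, and the head witness found in I lifts back along the
-- surjection h. Hence h⁻¹(I) ⊨ q, and since h is a homomorphism from h⁻¹(I) to I
-- acting as τ on constants, I ⊨ τ(q). Well-formedness of (τ(D), τ(q)) is syntactic.
module Submission where

open import Defs
open import Data.Nat using (ℕ; zero; suc; _≟_)
open import Data.Product using (∃; _×_; _,_; proj₁; proj₂; map₁; map₂)
open import Data.Sum using (inj₁; inj₂)
import Data.Sum as Sum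
open import Data.Sum.Properties using (≡-dec)
open import Data.List using ([]; _∷_)
import Data.List.Relation.Unary.All as All
import Data.List.Relation.Unary.All.Properties as All
open import Data.List.Relation.Unary.Any using (here; there)
import Data.List.Relation.Unary.Any as Any
open import Data.Vec using (Vec)
import Data.Vec as Vec
import Data.Vec.Properties as Vec
import Data.Vec.Relation.Unary.Any.Properties as VecAny
open import Data.Vec.Membership.Propositional using (find) renaming (_∈_ to _∈ᵥ_)
open import Data.Vec.Membership.Propositional.Properties using (∈-map⁺)
open import Function using (_∘_; id)
open import Relation.Binary.PropositionalEquality
  using (_≡_; _≗_; refl; sym; trans; cong; subst)
open import Relation.Nullary using (Dec; yes; no; contradiction)

∈ᵥ-map⁻ : {A B : Set} {n : ℕ} (f : A → B) {y : B} {xs : Vec A n} →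
          y ∈ᵥ Vec.map f xs → ∃ λ x → x ∈ᵥ xs × y ≡ f x
∈ᵥ-map⁻ f = find ∘ VecAny.map⁻

mapAtom-∘ : {A B C : Set} (f : B → C) (g : A → B) (a : Atom A) →
            mapAtom f (mapAtom g a) ≡ mapAtom (f ∘ g) a
mapAtom-∘ f g (R ⟨ ts ⟩) = cong (R ⟨_⟩) (sym (Vec.map-∘ f g ts))

mapAtom-cong : {A B : Set} {f g : A → B} → f ≗ g → mapAtom f ≗ mapAtom g
mapAtom-cong f≗g (R ⟨ ts ⟩) = cong (R ⟨_⟩) (Vec.map-cong f≗g ts)

preimage : (Dom → Dom) → Instance → Instance
preimage h I a = I (mapAtom h a)

_≟Dom_ : (d e : Dom) → Dec (d ≡ e)
_≟Dom_ = ≡-dec _≟_ _≟_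

module _ (h : Dom → Dom) (I : Instance) where

  holdsConj-preimage⁻ : ∀ g as → HoldsConj (preimage h I) g as → HoldsConj I (h ∘ g) as
  holdsConj-preimage⁻ g as = All.map (subst I (mapAtom-∘ h g _))

  holdsConj-preimage⁺ : ∀ g g' → h ∘ g ≗ g' → ∀ as →
                        HoldsConj I g' as → HoldsConj (preimage h I) g as
  holdsConj-preimage⁺ g g' hg≗g' as =
    All.map (λ {a} → subst I (sym (trans (mapAtom-∘ h g a) (mapAtom-cong hg≗g' a))))

  module _ (s : Dom → Dom) (h∘s≗id : h ∘ s ≗ id) where

    -- On body variables g' x ≡ h (g x), so the lift keeps g there as the DTGD semantics demands.
    liftAlong : (g g' : Var → Dom) → Var → Dom
    liftAlong g g' x with h (g x) ≟Dom g' x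
    ... | yes _ = g x
    ... | no  _ = s (g' x)

    h∘liftAlong : ∀ g g' → h ∘ liftAlong g g' ≗ g'
    h∘liftAlong g g' x with h (g x) ≟Dom g' x
    ... | yes hgx≡g'x = hgx≡g'x
    ... | no  _       = h∘s≗id (g' x)

    liftAlong-agrees : ∀ g g' x → g' x ≡ h (g x) → liftAlong g g' x ≡ g x
    liftAlong-agrees g g' x g'x≡hgx with h (g x) ≟Dom g' x
    ... | yes _         = refl
    ... | no  hgx≢g'x   = contradiction (sym g'x≡hgx) hgx≢g'x

    ⊨T-preimage : ∀ σ → I ⊨T σ → preimage h I ⊨T σ
    ⊨T-preimage σ I⊨σ g body-holds =
      Any.map lift-witness (I⊨σ (h ∘ g) (holdsConj-preimage⁻ g (body σ) body-holds))
      where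
      lift-witness : ∀ {ψ} →
        (∃ λ g' → (∀ x → OccursIn x (body σ) → g' x ≡ h (g x)) × HoldsConj I g' ψ) →
        (∃ λ g'' → (∀ x → OccursIn x (body σ) → g'' x ≡ g x) × HoldsConj (preimage h I) g'' ψ)
      lift-witness {ψ} (g' , agrees , holds) =
        liftAlong g g' ,
        (λ x occ → liftAlong-agrees g g' x (agrees x occ)) ,
        holdsConj-preimage⁺ (liftAlong g g') g' (h∘liftAlong g g') ψ holds

    ⊨Σ-preimage : ∀ Σ' → I ⊨Σ Σ' → preimage h I ⊨Σ Σ'
    ⊨Σ-preimage Σ' = All.map (⊨T-preimage _)

module _ (τ : PartialFun) (h : Dom → Dom) (h-on-consts : ∀ c → h (inj₁ c) ≡ inj₁ (applyτ τ c)) where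

  satQ-hom : (J I : Instance) → (∀ a → J a → I (mapAtom h a)) →
             ∀ p (μ ν : Var → Dom) → h ∘ μ ≗ ν → SatQ J μ p → SatQ I ν (substQ τ p)
  satQ-hom J I hom (atom a) μ ν h∘μ≗ν J⊨a =
    subst I (h-on-atom) (hom _ J⊨a)
    where
    evalTerm-subst : h ∘ evalTerm μ ≗ evalTerm ν ∘ substTerm τ
    evalTerm-subst (var x) = h∘μ≗ν x
    evalTerm-subst (cst c) = h-on-consts c
    h-on-atom : mapAtom h (mapAtom (evalTerm μ) a) ≡ mapAtom (evalTerm ν) (mapAtom (substTerm τ) a)
    h-on-atom = trans (mapAtom-∘ h (evalTerm μ) a)
                 (trans (mapAtom-cong evalTerm-subst a) (sym (mapAtom-∘ (evalTerm ν) (substTerm τ) a)))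
  satQ-hom J I hom (p ∧ q) μ ν h∘μ≗ν (sp , sq) =
    satQ-hom J I hom p μ ν h∘μ≗ν sp , satQ-hom J I hom q μ ν h∘μ≗ν sq
  satQ-hom J I hom (p ∨ q) μ ν h∘μ≗ν =
    Sum.map (satQ-hom J I hom p μ ν h∘μ≗ν) (satQ-hom J I hom q μ ν h∘μ≗ν)
  satQ-hom J I hom (ex x p) μ ν h∘μ≗ν (d , sp) =
    h d , satQ-hom J I hom p (update μ x d) (update ν x (h d)) h∘update sp
    where
    h∘update : h ∘ update μ x d ≗ update ν x (h d)
    h∘update y with y ≟ x
    ... | yes _ = refl
    ... | no  _ = h∘μ≗ν y

  contains-preimage : ∀ I D → Contains I (substDB τ D) → Contains (preimage h I) D
  contains-preimage I D =
    All.map (λ {f} → subst I (h-on-fact f)) ∘ All.map⁻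
    where
    h-on-fact : ∀ f → mapAtom inj₁ (mapAtom (applyτ τ) f) ≡ mapAtom h (mapAtom inj₁ f)
    h-on-fact f = trans (mapAtom-∘ inj₁ (applyτ τ) f)
                    (trans (mapAtom-cong (sym ∘ h-on-consts) f) (sym (mapAtom-∘ h inj₁ f)))

bump : Dom → Dom
bump = Sum.map suc suc

decodeDom : Null → Dom
decodeDom zero          = inj₁ zero
decodeDom (suc zero)    = inj₂ zero
decodeDom (suc (suc n)) = bump (decodeDom n)

encodeDom : Dom → Null
encodeDom (inj₁ zero)    = 0
encodeDom (inj₁ (suc c)) = suc (suc (encodeDom (inj₁ c)))
encodeDom (inj₂ zero)    = 1
encodeDom (inj₂ (suc m)) = suc (suc (encodeDom (inj₂ m)))

decodeDom∘encodeDom : decodeDom ∘ encodeDom ≗ id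
decodeDom∘encodeDom (inj₁ zero)    = refl
decodeDom∘encodeDom (inj₁ (suc c)) = cong bump (decodeDom∘encodeDom (inj₁ c))
decodeDom∘encodeDom (inj₂ zero)    = refl
decodeDom∘encodeDom (inj₂ (suc m)) = cong bump (decodeDom∘encodeDom (inj₂ m))

substDom : PartialFun → Dom → Dom
substDom τ (inj₁ c) = inj₁ (applyτ τ c)
substDom τ (inj₂ n) = decodeDom n

substDomSection : Dom → Dom
substDomSection = inj₂ ∘ encodeDom

entails-subst : ∀ τ D Σ' q → Entails D Σ' q → Entails (substDB τ D) Σ' (substQ τ q)
entails-subst τ D Σ' q D∪Σ⊨q I I⊇τD I⊨Σ ν =
  satQ-hom τ h (λ _ → refl) (preimage h I) I (λ _ → id) q
    (substDomSection ∘ ν) ν (decodeDom∘encodeDom ∘ ν)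
    (D∪Σ⊨q (preimage h I)
      (contains-preimage τ h (λ _ → refl) I D I⊇τD)
      (⊨Σ-preimage h I substDomSection decodeDom∘encodeDom Σ' I⊨Σ)
      (substDomSection ∘ ν))
  where
  h : Dom → Dom
  h = substDom τ

module _ (τ : PartialFun) where

  nonEmpty-subst : ∀ D → NonEmpty D → NonEmpty (substDB τ D)
  nonEmpty-subst []      D≢[] _ = D≢[] refl
  nonEmpty-subst (_ ∷ _) _    ()

  isSchemaDB-subst : ∀ 𝒟 D → IsSchemaDB 𝒟 D → IsSchemaDB 𝒟 (substDB τ D)
  isSchemaDB-subst 𝒟 D = All.map⁺

  overSchema-subst : ∀ 𝒬 p → OverSchema 𝒬 p → OverSchema 𝒬 (substQ τ p)
  overSchema-subst 𝒬 (atom _) (atom R∈𝒬) = atom R∈𝒬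
  overSchema-subst 𝒬 (p ∧ q)  (op ∧ oq)  = overSchema-subst 𝒬 p op ∧ overSchema-subst 𝒬 q oq
  overSchema-subst 𝒬 (p ∨ q)  (op ∨ oq)  = overSchema-subst 𝒬 p op ∨ overSchema-subst 𝒬 q oq
  overSchema-subst 𝒬 (ex _ p) (ex op)    = ex (overSchema-subst 𝒬 p op)

  substTerm-var⁻ : ∀ {x} t → var x ≡ substTerm τ t → var x ≡ t
  substTerm-var⁻ (var _) eq = eq

  substTerm-cst⁻ : ∀ {c} t → cst c ≡ substTerm τ t → ∃ λ c' → cst c' ≡ t × c ≡ applyτ τ c'
  substTerm-cst⁻ (cst c') refl = c' , refl , refl

  freeIn-substQ⁻ : ∀ x p → FreeIn x (substQ τ p) → FreeIn x p
  freeIn-substQ⁻ x (atom (_ ⟨ ts ⟩)) (atom x∈) with ∈ᵥ-map⁻ (substTerm τ) x∈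
  ... | t , t∈ts , eq = atom (subst (_∈ᵥ ts) (sym (substTerm-var⁻ t eq)) t∈ts)
  freeIn-substQ⁻ x (p ∧ q)  (∧ˡ f)   = ∧ˡ (freeIn-substQ⁻ x p f)
  freeIn-substQ⁻ x (p ∧ q)  (∧ʳ f)   = ∧ʳ (freeIn-substQ⁻ x q f)
  freeIn-substQ⁻ x (p ∨ q)  (∨ˡ f)   = ∨ˡ (freeIn-substQ⁻ x p f)
  freeIn-substQ⁻ x (p ∨ q)  (∨ʳ f)   = ∨ʳ (freeIn-substQ⁻ x q f)
  freeIn-substQ⁻ x (ex _ p) (ex x≢ f) = ex x≢ (freeIn-substQ⁻ x p f)

  constIn-substQ⁻ : ∀ c p → ConstIn c (substQ τ p) → ∃ λ c' → ConstIn c' p × c ≡ applyτ τ c'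
  constIn-substQ⁻ c (atom (_ ⟨ ts ⟩)) (atom c∈) with ∈ᵥ-map⁻ (substTerm τ) c∈
  ... | t , t∈ts , eq with substTerm-cst⁻ t eq
  ... | c' , refl , c≡τc' = c' , atom t∈ts , c≡τc'
  constIn-substQ⁻ c (p ∧ q)  (∧ˡ i) = map₂ (map₁ ∧ˡ) (constIn-substQ⁻ c p i)
  constIn-substQ⁻ c (p ∧ q)  (∧ʳ i) = map₂ (map₁ ∧ʳ) (constIn-substQ⁻ c q i)
  constIn-substQ⁻ c (p ∨ q)  (∨ˡ i) = map₂ (map₁ ∨ˡ) (constIn-substQ⁻ c p i)
  constIn-substQ⁻ c (p ∨ q)  (∨ʳ i) = map₂ (map₁ ∨ʳ) (constIn-substQ⁻ c q i)
  constIn-substQ⁻ c (ex _ p) (ex i) = map₂ (map₁ ex) (constIn-substQ⁻ c p i)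

  adom-subst⁺ : ∀ c D → c ∈adom D → applyτ τ c ∈adom substDB τ D
  adom-subst⁺ c ((_ ⟨ ts ⟩) ∷ D) (here c∈) = here (∈-map⁺ (applyτ τ) c∈)
  adom-subst⁺ c (_ ∷ D)          (there c∈) = there (adom-subst⁺ c D c∈)

  wellFormedPair-subst : ∀ 𝒟 𝒬 D q → WellFormedPair 𝒟 𝒬 D q →
                         WellFormedPair 𝒟 𝒬 (substDB τ D) (substQ τ q)
  wellFormedPair-subst 𝒟 𝒬 D q (D≢[] , D⊆𝒟 , closed , q⊆𝒬 , consts⊆adom) =
    nonEmpty-subst D D≢[] ,
    isSchemaDB-subst 𝒟 D D⊆𝒟 ,
    (λ x → closed x ∘ freeIn-substQ⁻ x q) ,
    overSchema-subst 𝒬 q q⊆𝒬 ,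
    λ c c∈q → consts-adom (constIn-substQ⁻ c q c∈q)
    where
    consts-adom : ∀ {c} → (∃ λ c' → ConstIn c' q × c ≡ applyτ τ c') → c ∈adom substDB τ D
    consts-adom (c' , c'∈q , refl) = adom-subst⁺ c' D (consts⊆adom c' c'∈q)

proposition3 : (𝒟 𝒬 : Schema) → Disjoint 𝒟 𝒬 →
    (O : Ontology) → IsDTGDOntology 𝒟 𝒬 O →
    (D : Database) (q : UCQ) → O D q →
    (τ : PartialFun) → O (substDB τ D) (substQ τ q)
proposition3 𝒟 𝒬 _ O (Σ' , O≡models) D q Dq∈O τ =
  proj₂ (O≡models (substDB τ D) (substQ τ q))
    (wellFormedPair-subst τ 𝒟 𝒬 D q wellFormed)
    (entails-subst τ D Σ' q D∪Σ⊨q)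
  where
  wellFormed : WellFormedPair 𝒟 𝒬 D q
  wellFormed = proj₁ (proj₁ (O≡models D q) Dq∈O)
  D∪Σ⊨q : Entails D Σ' q
  D∪Σ⊨q = proj₂ (proj₁ (O≡models D q) Dq∈O)
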